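{- Let $\{V_n\}_{n\geq 0}$ be the sequence defined by $V_0=1$, $V_1=8$ and \[ n(n+1)^2 V_{n+1}=8n(3n^2+5n+1)V_n-128(n-1)(n+1)^2V_{n-1}, \quad \text{for } n\geq 1. \] Then the sequence $\{\sqrt[n]{V_{n+1}}\}_{n\geq 1}$ is strictly decreasing.
   Context: The sequence $\{V_n\}$ is the Fennessey-Larcombe-French sequence. -}

module Defs where

open import Data.Nat using (ℕ; zero; suc)
open import Data.Integer using (+_)
open import Data.Rational using (ℚ; _/_; _*_; _-_; 1ℚ)
open import Relation.Binary.PropositionalEquality using (_≡_)
import Data.Nat

ℕ→ℚ : ℕ → ℚ
ℕ→ℚ n = (+ n) / 1

_^ℚ_ : ℚ → ℕ → ℚ
q ^ℚ zero  = 1ℚ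
q ^ℚ suc k = q * (q ^ℚ k)

-- Written with m = n - 1 (so n = suc m, n - 1 = m, n + 1 = suc (suc m)).
record IsFLF (V : ℕ → ℚ) : Set where
  field
    V0  : V 0 ≡ (+ 1) / 1
    V1  : V 1 ≡ (+ 8) / 1
    rec : ∀ (m : ℕ) →
      ℕ→ℚ (suc m) * ℕ→ℚ (suc (suc m)) * ℕ→ℚ (suc (suc m)) * V (suc (suc m))
        ≡ (+ 8) / 1 * ℕ→ℚ (suc m) * ℕ→ℚ (3 Data.Nat.* suc m Data.Nat.* suc m Data.Nat.+ 5 Data.Nat.* suc m Data.Nat.+ 1) * V (suc m)
          - (+ 128) / 1 * ℕ→ℚ m * ℕ→ℚ (suc (suc m)) * ℕ→ℚ (suc (suc m)) * V m

{-# OPTIONS --safe #-}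
module Submission where

-- The ratio V(n)/V(n-1) stays above 16 (1 + 1/(n+1)³): the recurrence carries this bound from
-- one index to the next, and the bound lies to the right of both roots of the quadratic
-- n(n+1)² t² - 8n(3n²+5n+1) t + 128(n-1)(n+1)² (asymptotically t² - 24 t + 128, with roots 8
-- and 16). There the quadratic is positive, which by the recurrence says V(n+1) V(n-1) < V(n)².
-- For a positive, strictly log-concave sequence with V 1 ≥ 1 the roots V(n+1)^(1/n) decrease
-- strictly. All coefficient inequalities involved are polynomial inequalities in n whose
-- difference has nonnegative coefficients.

open import Defs
open import Data.Nat using (ℕ; zero; suc; _≥_)
open import Data.List using (_∷_; [])
open import Data.Product using (_×_; _,_; proj₁; proj₂)
open import Data.Unit using (tt)
open import Function using (_∘_)
open import Level using (0ℓ)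
open import Relation.Binary.PropositionalEquality
  using (_≡_; refl; sym; trans; cong; cong₂; subst; subst₂; module ≡-Reasoning)
open import Relation.Nullary.Decidable using (dec⇒maybe; toWitness)
open import Tactic.RingSolver using (solve-∀; solve)
open import Tactic.RingSolver.Core.AlmostCommutativeRing
  using (AlmostCommutativeRing; fromCommutativeRing)
import Data.Nat as ℕ
import Data.Nat.Properties as ℕ
import Data.Nat.Tactic.RingSolver as ℕ-Solver
open import Data.Integer using (+_)
import Data.Integer as ℤ
import Data.Integer.Properties as ℤ
import Data.Nat.Coprimality as Coprimality
import Data.Rational.Properties as ℚ
import Algebra.Properties.CommutativeSemigroup as CommutativeSemigroupProperties
open import Algebra.Bundles using (CommutativeMonoid)

-- At n = m + 2 the recurrence reads α V(n+1) + γ V(n-1) = β V(n), and ε/δ = 16 (1 + 1/(n+1)³)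
-- is the lower bound kept by V(n)/V(n-1).
module Coefficients where
  open import Data.Nat using (_+_; _*_; _≤_)

  α β γ δ ε : ℕ → ℕ
  α m = (2 + m) * (3 + m) * (3 + m)
  β m = 8 * (2 + m) * (3 * (2 + m) * (2 + m) + 5 * (2 + m) + 1)
  γ m = 128 * (1 + m) * (3 + m) * (3 + m)
  δ m = (3 + m) * (3 + m) * (3 + m)
  ε m = 16 * (δ m + 1)

  -- The ring solver cannot unfold α … ε, so each identity below spells them out.
  ≤-by-remainder : ∀ {a r b} → a + r ≡ b → a ≤ b
  ≤-by-remainder {a} {r} refl = ℕ.m≤m+n a r

  ratio-coefficients : ∀ m →
    ε (suc m) * α m * ε m + δ (suc m) * γ m * δ m ≤ δ (suc m) * β m * ε m
  ratio-coefficients m = ≤-by-remainder (identity m)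
    where
    identity : ∀ m →
      let D = (3 + m) * (3 + m) * (3 + m)
          F = (4 + m) * (4 + m) * (4 + m)
      in 16 * (F + 1) * ((2 + m) * (3 + m) * (3 + m)) * (16 * (D + 1))
           + F * (128 * (1 + m) * (3 + m) * (3 + m)) * D
           + (m * (m * (m * (m * (m * 768 + 11520) + 68480) + 201984) + 296448) + 174080)
         ≡ F * (8 * (2 + m) * (3 * (2 + m) * (2 + m) + 5 * (2 + m) + 1)) * (16 * (D + 1))
    identity = ℕ-Solver.solve-∀

  slope-coefficients : ∀ m → β m * δ m ≤ α m * ε m + α m * ε m
  slope-coefficients m = ≤-by-remainder (identity m)
    where
    identity : ∀ m →
      let D = (3 + m) * (3 + m) * (3 + m)
          c₁ = (2 + m) * (3 + m) * (3 + m)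
      in 8 * (2 + m) * (3 * (2 + m) * (2 + m) + 5 * (2 + m) + 1) * D
           + (m * (m * (m * (m * (m * (m * 8 + 144) + 1080) + 4344) + 9904) + 12120) + 6192)
         ≡ c₁ * (16 * (D + 1)) + c₁ * (16 * (D + 1))
    identity = ℕ-Solver.solve-∀

  value-coefficients : ∀ m → β m * δ m * ε m ≤ α m * ε m * ε m + γ m * δ m * δ m
  value-coefficients m = ≤-by-remainder (identity m)
    where
    identity : ∀ m →
      let D = (3 + m) * (3 + m) * (3 + m)
          E = 16 * (D + 1)
      in 8 * (2 + m) * (3 * (2 + m) * (2 + m) + 5 * (2 + m) + 1) * D * E
           + (m * (m * (m * 128 + 896) + 1920) + 1152)
         ≡ (2 + m) * (3 + m) * (3 + m) * E * E + 128 * (1 + m) * (3 + m) * (3 + m) * D * D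
    identity = ℕ-Solver.solve-∀

open Coefficients

open import Data.Rational
  using (ℚ; 0ℚ; 1ℚ; _<_; _≤_; _+_; _*_; _-_; -_; _/_; 1/_; mkℚ; positive; nonNegative; _<?_; _≤?_)

ℚ-ring : AlmostCommutativeRing 0ℓ 0ℓ
ℚ-ring = fromCommutativeRing ℚ.+-*-commutativeRing (λ x → dec⇒maybe (0ℚ ℚ.≟ x))

ℕ→ℚ≡mkℚ : ∀ n → ℕ→ℚ n ≡ mkℚ (+ n) 0 (Coprimality.sym (Coprimality.1-coprimeTo n))
ℕ→ℚ≡mkℚ n = ℚ.normalize-coprime _

ℕ→ℚ-+ : ∀ m n → ℕ→ℚ (m ℕ.+ n) ≡ ℕ→ℚ m + ℕ→ℚ n
ℕ→ℚ-+ m n rewrite ℕ→ℚ≡mkℚ m | ℕ→ℚ≡mkℚ n =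
  cong (_/ 1) (sym (cong₂ ℤ._+_ (ℤ.*-identityʳ (+ m)) (ℤ.*-identityʳ (+ n))))

ℕ→ℚ-* : ∀ m n → ℕ→ℚ (m ℕ.* n) ≡ ℕ→ℚ m * ℕ→ℚ n
ℕ→ℚ-* m n rewrite ℕ→ℚ≡mkℚ m | ℕ→ℚ≡mkℚ n = cong (_/ 1) (sym (ℤ.+◃n≡+n (m ℕ.* n)))

ℕ→ℚ-*³ : ∀ a b c → ℕ→ℚ (a ℕ.* b ℕ.* c) ≡ ℕ→ℚ a * ℕ→ℚ b * ℕ→ℚ c
ℕ→ℚ-*³ a b c = trans (ℕ→ℚ-* (a ℕ.* b) c) (cong (_* ℕ→ℚ c) (ℕ→ℚ-* a b))

ℕ→ℚ-pos : ∀ n .{{_ : ℕ.NonZero n}} → 0ℚ < ℕ→ℚ n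
ℕ→ℚ-pos n = ℚ.positive⁻¹ _ {{ℚ.normalize-pos n 1}}

ℕ→ℚ-nonNeg : ∀ n → 0ℚ ≤ ℕ→ℚ n
ℕ→ℚ-nonNeg n = ℚ.nonNegative⁻¹ _ {{ℚ.normalize-nonNeg n 1}}

ℕ→ℚ-mono-≤ : ∀ {m n} → m ℕ.≤ n → ℕ→ℚ m ≤ ℕ→ℚ n
ℕ→ℚ-mono-≤ {m} {n} m≤n = begin
  ℕ→ℚ m                       ≡⟨ sym (ℚ.+-identityʳ (ℕ→ℚ m)) ⟩
  ℕ→ℚ m + 0ℚ                  ≤⟨ ℚ.+-monoʳ-≤ (ℕ→ℚ m) (ℕ→ℚ-nonNeg (n ℕ.∸ m)) ⟩
  ℕ→ℚ m + ℕ→ℚ (n ℕ.∸ m)       ≡⟨ sym (ℕ→ℚ-+ m (n ℕ.∸ m)) ⟩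
  ℕ→ℚ (m ℕ.+ (n ℕ.∸ m))       ≡⟨ cong ℕ→ℚ (ℕ.m+[n∸m]≡n m≤n) ⟩
  ℕ→ℚ n                       ∎
  where open ℚ.≤-Reasoning

*-pos : ∀ {p q} → 0ℚ < p → 0ℚ < q → 0ℚ < p * q
*-pos {p} {q} 0<p 0<q =
  ℚ.positive⁻¹ (p * q) {{ℚ.pos*pos⇒pos p {{positive 0<p}} q {{positive 0<q}}}}

*-nonNeg : ∀ {p q} → 0ℚ ≤ p → 0ℚ ≤ q → 0ℚ ≤ p * q
*-nonNeg {p} {q} 0≤p 0≤q =
  ℚ.nonNegative⁻¹ (p * q) {{ℚ.nonNeg*nonNeg⇒nonNeg p {{nonNegative 0≤p}} q {{nonNegative 0≤q}}}}

-- ʳ/ˡ name the varying factor, as in Data.Nat.Properties (Data.Rational.Properties mixes conventions).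
*-monoʳ-≤ : ∀ {r p q} → 0ℚ ≤ r → p ≤ q → r * p ≤ r * q
*-monoʳ-≤ {r} 0≤r = ℚ.*-monoˡ-≤-nonNeg r {{nonNegative 0≤r}}

*-monoʳ-< : ∀ {r p q} → 0ℚ < r → p < q → r * p < r * q
*-monoʳ-< {r} 0<r = ℚ.*-monoʳ-<-pos r {{positive 0<r}}

*-monoˡ-< : ∀ {r p q} → 0ℚ < r → p < q → p * r < q * r
*-monoˡ-< {r} 0<r = ℚ.*-monoˡ-<-pos r {{positive 0<r}}

*-cancelˡ-< : ∀ {r p q} → 0ℚ ≤ r → r * p < r * q → p < q
*-cancelˡ-< {r} 0≤r = ℚ.*-cancelˡ-<-nonNeg r {{nonNegative 0≤r}}

*-cancelʳ-< : ∀ {r p q} → 0ℚ ≤ r → p * r < q * r → p < q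
*-cancelʳ-< {r} 0≤r = ℚ.*-cancelʳ-<-nonNeg r {{nonNegative 0≤r}}

+-cancelʳ-< : ∀ {r p q} → p + r < q + r → p < q
+-cancelʳ-< {r} {p} {q} p+r<q+r =
  subst₂ _<_ (cancel p r) (cancel q r) (ℚ.+-monoˡ-< (- r) p+r<q+r)
  where
  cancel : ∀ x y → x + y + - y ≡ x
  cancel = solve-∀ ℚ-ring

*-pos-cancelˡ : ∀ {c x} → 0ℚ ≤ c → 0ℚ < c * x → 0ℚ < x
*-pos-cancelˡ {c} {x} 0≤c 0<cx =
  *-cancelˡ-< 0≤c (subst (_< c * x) (sym (ℚ.*-zeroʳ c)) 0<cx)

p<q⇒0<q-p : ∀ {p q} → p < q → 0ℚ < q - p
p<q⇒0<q-p {p} {q} p<q = subst (_< q - p) (ℚ.+-inverseʳ p) (ℚ.+-monoˡ-< (- p) p<q)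

x≡y-z⇒x+z≡y : ∀ {x y z} → x ≡ y - z → x + z ≡ y
x≡y-z⇒x+z≡y {x} {y} {z} refl = cancel y z
  where
  cancel : ∀ y z → y - z + z ≡ y
  cancel = solve-∀ ℚ-ring

^ℚ-pos : ∀ {x} → 0ℚ < x → ∀ k → 0ℚ < x ^ℚ k
^ℚ-pos 0<x zero    = ℚ.positive⁻¹ 1ℚ
^ℚ-pos 0<x (suc k) = *-pos 0<x (^ℚ-pos 0<x k)

^ℚ-distrib-* : ∀ x y k → (x * y) ^ℚ k ≡ x ^ℚ k * y ^ℚ k
^ℚ-distrib-* x y zero    = refl
^ℚ-distrib-* x y (suc k) =
  trans (cong (x * y *_) (^ℚ-distrib-* x y k)) (interchange x y (x ^ℚ k) (y ^ℚ k))
  where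
  open CommutativeSemigroupProperties
         (CommutativeMonoid.commutativeSemigroup ℚ.*-1-commutativeMonoid) using (interchange)

^ℚ-monoˡ-< : ∀ {x y} → 0ℚ ≤ x → x < y → ∀ k → x ^ℚ suc k < y ^ℚ suc k
^ℚ-monoˡ-< {x} {y} 0≤x x<y zero = *-monoˡ-< (ℚ.positive⁻¹ 1ℚ) x<y
^ℚ-monoˡ-< {x} {y} 0≤x x<y (suc k) = begin-strict
  x * x ^ℚ suc k  ≤⟨ *-monoʳ-≤ 0≤x (ℚ.<⇒≤ (^ℚ-monoˡ-< 0≤x x<y k)) ⟩
  x * y ^ℚ suc k  <⟨ *-monoˡ-< (^ℚ-pos (ℚ.≤-<-trans 0≤x x<y) (suc k)) x<y ⟩
  y * y ^ℚ suc k  ∎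
  where open ℚ.≤-Reasoning

log-concave⇒root-decreasing : (a : ℕ → ℚ) → (∀ k → 0ℚ < a k) → 1ℚ ≤ a 0 →
  (∀ k → a (2 ℕ.+ k) * a k < a (1 ℕ.+ k) * a (1 ℕ.+ k)) →
  ∀ k → a (2 ℕ.+ k) ^ℚ (1 ℕ.+ k) < a (1 ℕ.+ k) ^ℚ (2 ℕ.+ k)
log-concave⇒root-decreasing a pos 1≤a₀ concave zero = begin-strict
  a 2 * 1ℚ          ≤⟨ *-monoʳ-≤ (ℚ.<⇒≤ (pos 2)) 1≤a₀ ⟩
  a 2 * a 0         <⟨ concave 0 ⟩
  a 1 * a 1         ≡⟨ cong (a 1 *_) (sym (ℚ.*-identityʳ (a 1))) ⟩
  a 1 * (a 1 * 1ℚ)  ∎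
  where open ℚ.≤-Reasoning
log-concave⇒root-decreasing a pos 1≤a₀ concave (suc k) =
  *-cancelʳ-< (ℚ.<⇒≤ (^ℚ-pos (pos (1 ℕ.+ k)) (2 ℕ.+ k))) (begin-strict
    a₃ ^ℚ (2 ℕ.+ k) * a₁ ^ℚ (2 ℕ.+ k)  ≡⟨ sym (^ℚ-distrib-* a₃ a₁ (2 ℕ.+ k)) ⟩
    (a₃ * a₁) ^ℚ (2 ℕ.+ k)             <⟨ ^ℚ-monoˡ-< 0≤a₃a₁ (concave (suc k)) (suc k) ⟩
    (a₂ * a₂) ^ℚ (2 ℕ.+ k)             ≡⟨ ^ℚ-distrib-* a₂ a₂ (2 ℕ.+ k) ⟩
    a₂ ^ℚ (2 ℕ.+ k) * a₂ ^ℚ (2 ℕ.+ k)  ≡⟨ regroup a₂ (a₂ ^ℚ (1 ℕ.+ k)) ⟩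
    a₂ ^ℚ (3 ℕ.+ k) * a₂ ^ℚ (1 ℕ.+ k)  <⟨ *-monoʳ-< (^ℚ-pos (pos (2 ℕ.+ k)) (3 ℕ.+ k))
                                            (log-concave⇒root-decreasing a pos 1≤a₀ concave k) ⟩
    a₂ ^ℚ (3 ℕ.+ k) * a₁ ^ℚ (2 ℕ.+ k)  ∎)
  where
  open ℚ.≤-Reasoning
  a₁ a₂ a₃ : ℚ
  a₁ = a (1 ℕ.+ k)
  a₂ = a (2 ℕ.+ k)
  a₃ = a (3 ℕ.+ k)
  0≤a₃a₁ : 0ℚ ≤ a₃ * a₁
  0≤a₃a₁ = ℚ.<⇒≤ (*-pos (pos (3 ℕ.+ k)) (pos (1 ℕ.+ k)))
  regroup : ∀ z w → z * w * (z * w) ≡ z * (z * w) * w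
  regroup = solve-∀ ℚ-ring

ratio-bound-step : ∀ {c₁ c₂ c₃ D E F G a b x} →
  0ℚ ≤ c₁ → 0ℚ ≤ E → 0ℚ < F → 0ℚ < c₃ → 0ℚ ≤ a →
  G * c₁ * E + F * c₃ * D ≤ F * c₂ * E →
  c₁ * x + c₃ * b ≡ c₂ * a → E * b < D * a → G * a < F * x
ratio-bound-step {c₁} {c₂} {c₃} {D} {E} {F} {G} {a} {b} {x}
  0≤c₁ 0≤E 0<F 0<c₃ 0≤a coefficients recurrence Eb<Da =
  *-cancelˡ-< (*-nonNeg 0≤E 0≤c₁) (+-cancelʳ-< (begin-strict
    E * c₁ * (G * a) + F * c₃ * (D * a) ≡⟨ solve (E ∷ c₁ ∷ G ∷ a ∷ F ∷ c₃ ∷ D ∷ []) ℚ-ring ⟩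
    (G * c₁ * E + F * c₃ * D) * a       ≤⟨ ℚ.*-monoʳ-≤-nonNeg a {{nonNegative 0≤a}} coefficients ⟩
    F * c₂ * E * a                      ≡⟨ solve (F ∷ c₂ ∷ E ∷ a ∷ []) ℚ-ring ⟩
    E * F * (c₂ * a)                    ≡⟨ cong (E * F *_) (sym recurrence) ⟩
    E * F * (c₁ * x + c₃ * b)           ≡⟨ solve (E ∷ F ∷ c₁ ∷ x ∷ c₃ ∷ b ∷ []) ℚ-ring ⟩
    E * c₁ * (F * x) + F * c₃ * (E * b) <⟨ ℚ.+-monoʳ-< (E * c₁ * (F * x)) (*-monoʳ-< (*-pos 0<F 0<c₃) Eb<Da) ⟩
    E * c₁ * (F * x) + F * c₃ * (D * a) ∎))
  where open ℚ.≤-Reasoning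

-- With u = D a - E b, D² (c₁ a² - c₂ a b + c₃ b²) = c₁ u² + u b (2 c₁ E - c₂ D) + b² (c₁ E² + c₃ D² - c₂ D E):
-- at t = E/D the quadratic c₁ t² - c₂ t + c₃ and its slope are nonnegative, so it is positive beyond.
quadratic-pos : ∀ {c₁ c₂ c₃ D E a b} → 0ℚ < c₁ → 0ℚ ≤ D → 0ℚ ≤ b →
  c₂ * D ≤ c₁ * E + c₁ * E → c₂ * D * E ≤ c₁ * E * E + c₃ * D * D →
  E * b < D * a → c₂ * (a * b) < c₁ * (a * a) + c₃ * (b * b)
quadratic-pos {c₁} {c₂} {c₃} {D} {E} {a} {b} 0<c₁ 0≤D 0≤b slope value Eb<Da =
  let u : ℚ
      u = D * a - E * b
      0<u : 0ℚ < u
      0<u = p<q⇒0<q-p Eb<Da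
      0≤u : 0ℚ ≤ u
      0≤u = ℚ.<⇒≤ 0<u
      lower-terms : u * b * (c₂ * D) + b * b * (c₂ * D * E)
                      < c₁ * u * u + (u * b * (c₁ * E + c₁ * E) + b * b * (c₁ * E * E + c₃ * D * D))
      lower-terms = subst (_< _) (ℚ.+-identityˡ _) (ℚ.+-mono-<-≤ (*-pos (*-pos 0<c₁ 0<u) 0<u)
        (ℚ.+-mono-≤ (*-monoʳ-≤ (*-nonNeg 0≤u 0≤b) slope) (*-monoʳ-≤ (*-nonNeg 0≤b 0≤b) value)))
  in *-cancelˡ-< (*-nonNeg 0≤D 0≤D) (+-cancelʳ-< (begin-strict
    D * D * (c₂ * (a * b)) + (u * b * (c₂ * D) + b * b * (c₂ * D * E))
      <⟨ ℚ.+-monoʳ-< (D * D * (c₂ * (a * b))) lower-terms ⟩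
    D * D * (c₂ * (a * b))
      + (c₁ * u * u + (u * b * (c₁ * E + c₁ * E) + b * b * (c₁ * E * E + c₃ * D * D)))
      ≡⟨ solve (D ∷ c₁ ∷ c₂ ∷ c₃ ∷ E ∷ a ∷ b ∷ []) ℚ-ring ⟩
    D * D * (c₁ * (a * a) + c₃ * (b * b)) + (u * b * (c₂ * D) + b * b * (c₂ * D * E)) ∎))
  where open ℚ.≤-Reasoning

log-concave-step : ∀ {c₁ c₂ c₃ D E a b x} → 0ℚ < c₁ → 0ℚ ≤ D → 0ℚ ≤ b →
  c₂ * D ≤ c₁ * E + c₁ * E → c₂ * D * E ≤ c₁ * E * E + c₃ * D * D →
  c₁ * x + c₃ * b ≡ c₂ * a → E * b < D * a → x * b < a * a
log-concave-step {c₁} {c₂} {c₃} {D} {E} {a} {b} {x}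
  0<c₁ 0≤D 0≤b slope value recurrence Eb<Da =
  *-cancelˡ-< (ℚ.<⇒≤ 0<c₁) (+-cancelʳ-< (begin-strict
    c₁ * (x * b) + c₃ * (b * b) ≡⟨ solve (c₁ ∷ x ∷ b ∷ c₃ ∷ []) ℚ-ring ⟩
    (c₁ * x + c₃ * b) * b       ≡⟨ cong (_* b) recurrence ⟩
    c₂ * a * b                  ≡⟨ ℚ.*-assoc c₂ a b ⟩
    c₂ * (a * b)                <⟨ quadratic-pos {c₂ = c₂} {c₃} 0<c₁ 0≤D 0≤b slope value Eb<Da ⟩
    c₁ * (a * a) + c₃ * (b * b) ∎))
  where open ℚ.≤-Reasoning

module _ {V : ℕ → ℚ} (flf : IsFLF V) where
  open IsFLF flf

  flf-recurrence : ∀ m →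
    ℕ→ℚ (α m) * V (3 ℕ.+ m) + ℕ→ℚ (γ m) * V (1 ℕ.+ m) ≡ ℕ→ℚ (β m) * V (2 ℕ.+ m)
  flf-recurrence m = x≡y-z⇒x+z≡y (trans (cong (_* V (3 ℕ.+ m)) α-factors) (trans (rec (suc m))
    (sym (cong₂ (λ p q → p * V (2 ℕ.+ m) - q * V (1 ℕ.+ m)) β-factors γ-factors))))
    where
    α-factors : ℕ→ℚ (α m) ≡ ℕ→ℚ (2 ℕ.+ m) * ℕ→ℚ (3 ℕ.+ m) * ℕ→ℚ (3 ℕ.+ m)
    α-factors = ℕ→ℚ-*³ (2 ℕ.+ m) (3 ℕ.+ m) (3 ℕ.+ m)
    β-factors : ℕ→ℚ (β m)
      ≡ ℕ→ℚ 8 * ℕ→ℚ (2 ℕ.+ m) * ℕ→ℚ (3 ℕ.* (2 ℕ.+ m) ℕ.* (2 ℕ.+ m) ℕ.+ 5 ℕ.* (2 ℕ.+ m) ℕ.+ 1)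
    β-factors = ℕ→ℚ-*³ 8 (2 ℕ.+ m) (3 ℕ.* (2 ℕ.+ m) ℕ.* (2 ℕ.+ m) ℕ.+ 5 ℕ.* (2 ℕ.+ m) ℕ.+ 1)
    γ-factors : ℕ→ℚ (γ m) ≡ ℕ→ℚ 128 * ℕ→ℚ (1 ℕ.+ m) * ℕ→ℚ (3 ℕ.+ m) * ℕ→ℚ (3 ℕ.+ m)
    γ-factors = trans (ℕ→ℚ-* (128 ℕ.* (1 ℕ.+ m) ℕ.* (3 ℕ.+ m)) (3 ℕ.+ m))
                      (cong (_* ℕ→ℚ (3 ℕ.+ m)) (ℕ→ℚ-*³ 128 (1 ℕ.+ m) (3 ℕ.+ m)))

  V₂≡144 : V 2 ≡ ℕ→ℚ 144
  V₂≡144 = begin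
    V 2                         ≡⟨ sym (ℚ.*-identityˡ (V 2)) ⟩
    1ℚ * V 2                    ≡⟨ cong (_* V 2) (sym (ℚ.*-inverseˡ (ℕ→ℚ 4))) ⟩
    1/ ℕ→ℚ 4 * ℕ→ℚ 4 * V 2      ≡⟨ ℚ.*-assoc (1/ ℕ→ℚ 4) (ℕ→ℚ 4) (V 2) ⟩
    1/ ℕ→ℚ 4 * (ℕ→ℚ 4 * V 2)    ≡⟨ cong (1/ ℕ→ℚ 4 *_) recurrence₀ ⟩
    1/ ℕ→ℚ 4 * ℕ→ℚ 576          ≡⟨⟩
    ℕ→ℚ 144                     ∎
    where
    open ≡-Reasoning
    recurrence₀ : ℕ→ℚ 4 * V 2 ≡ ℕ→ℚ 576
    recurrence₀ = trans (rec 0) (cong₂ (λ v₁ v₀ → ℕ→ℚ 72 * v₁ - ℕ→ℚ 0 * v₀) V1 V0)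

  RatioBound : ℕ → Set
  RatioBound m = ℕ→ℚ (ε m) * V (1 ℕ.+ m) < ℕ→ℚ (δ m) * V (2 ℕ.+ m)

  ratio-bound : ∀ m → 0ℚ < V (1 ℕ.+ m) × RatioBound m
  ratio-bound zero = subst (0ℚ <_) (sym V1) (ℕ→ℚ-pos 8) , initial
    where
    initial : RatioBound 0
    initial = subst₂ (λ v₁ v₂ → ℕ→ℚ (ε 0) * v₁ < ℕ→ℚ (δ 0) * v₂) (sym V1) (sym V₂≡144)
      (toWitness {a? = ℕ→ℚ 448 * ℕ→ℚ 8 <? ℕ→ℚ 27 * ℕ→ℚ 144} tt)
  ratio-bound (suc m) =
    let (0<b , bound) = ratio-bound m
        0<a : 0ℚ < V (2 ℕ.+ m)
        0<a = *-pos-cancelˡ (ℕ→ℚ-nonNeg (δ m)) (ℚ.<-trans (*-pos (ℕ→ℚ-pos (ε m)) 0<b) bound)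
    in 0<a , ratio-bound-step {ℕ→ℚ (α m)} {ℕ→ℚ (β m)} {ℕ→ℚ (γ m)} {ℕ→ℚ (δ m)} {ℕ→ℚ (ε m)}
               {ℕ→ℚ (δ (suc m))} {ℕ→ℚ (ε (suc m))}
               (ℕ→ℚ-nonNeg (α m)) (ℕ→ℚ-nonNeg (ε m)) (ℕ→ℚ-pos (δ (suc m))) (ℕ→ℚ-pos (γ m))
               (ℚ.<⇒≤ 0<a) coefficients (flf-recurrence m) bound
    where
    coefficients :
      ℕ→ℚ (ε (suc m)) * ℕ→ℚ (α m) * ℕ→ℚ (ε m) + ℕ→ℚ (δ (suc m)) * ℕ→ℚ (γ m) * ℕ→ℚ (δ m)
        ≤ ℕ→ℚ (δ (suc m)) * ℕ→ℚ (β m) * ℕ→ℚ (ε m)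
    coefficients = subst₂ _≤_
      (trans (ℕ→ℚ-+ (ε (suc m) ℕ.* α m ℕ.* ε m) (δ (suc m) ℕ.* γ m ℕ.* δ m))
             (cong₂ _+_ (ℕ→ℚ-*³ (ε (suc m)) (α m) (ε m)) (ℕ→ℚ-*³ (δ (suc m)) (γ m) (δ m))))
      (ℕ→ℚ-*³ (δ (suc m)) (β m) (ε m))
      (ℕ→ℚ-mono-≤ (ratio-coefficients m))

  V-pos : ∀ m → 0ℚ < V (suc m)
  V-pos m = proj₁ (ratio-bound m)

  1≤V₁ : 1ℚ ≤ V 1
  1≤V₁ = subst (1ℚ ≤_) (sym V1) (toWitness {a? = 1ℚ ≤? ℕ→ℚ 8} tt)

  V-log-concave : ∀ m → V (3 ℕ.+ m) * V (1 ℕ.+ m) < V (2 ℕ.+ m) * V (2 ℕ.+ m)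
  V-log-concave m = log-concave-step {ℕ→ℚ (α m)} {ℕ→ℚ (β m)} {ℕ→ℚ (γ m)} {ℕ→ℚ (δ m)} {ℕ→ℚ (ε m)}
    (ℕ→ℚ-pos (α m)) (ℕ→ℚ-nonNeg (δ m)) (ℚ.<⇒≤ (V-pos m))
    slope value (flf-recurrence m) (proj₂ (ratio-bound m))
    where
    slope : ℕ→ℚ (β m) * ℕ→ℚ (δ m) ≤ ℕ→ℚ (α m) * ℕ→ℚ (ε m) + ℕ→ℚ (α m) * ℕ→ℚ (ε m)
    slope = subst₂ _≤_ (ℕ→ℚ-* (β m) (δ m))
      (trans (ℕ→ℚ-+ (α m ℕ.* ε m) (α m ℕ.* ε m))
             (cong₂ _+_ (ℕ→ℚ-* (α m) (ε m)) (ℕ→ℚ-* (α m) (ε m))))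
      (ℕ→ℚ-mono-≤ (slope-coefficients m))
    value : ℕ→ℚ (β m) * ℕ→ℚ (δ m) * ℕ→ℚ (ε m)
              ≤ ℕ→ℚ (α m) * ℕ→ℚ (ε m) * ℕ→ℚ (ε m) + ℕ→ℚ (γ m) * ℕ→ℚ (δ m) * ℕ→ℚ (δ m)
    value = subst₂ _≤_ (ℕ→ℚ-*³ (β m) (δ m) (ε m))
      (trans (ℕ→ℚ-+ (α m ℕ.* ε m ℕ.* ε m) (γ m ℕ.* δ m ℕ.* δ m))
             (cong₂ _+_ (ℕ→ℚ-*³ (α m) (ε m) (ε m)) (ℕ→ℚ-*³ (γ m) (δ m) (δ m))))
      (ℕ→ℚ-mono-≤ (value-coefficients m))

proposition2p3 : (V : ℕ → ℚ) → IsFLF V →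
    ∀ (n : ℕ) → n ≥ 1 →
      (0ℚ < V (suc n)) × (0ℚ < V (suc (suc n))) ×
      ((V (suc (suc n)) ^ℚ n) < (V (suc n) ^ℚ suc n))
proposition2p3 V flf (suc k) _ =
  V-pos flf (suc k) , V-pos flf (suc (suc k)) ,
  log-concave⇒root-decreasing (V ∘ suc) (V-pos flf) (1≤V₁ flf) (V-log-concave flf) k
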